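{- Let $(u,v,w)$ be a path whose two edges $\{u,v\}$ and $\{v,w\}$ carry arbitrary signs $\sigma_1,\sigma_2\in\{+,-\}$. For every triangle free set $S_1\subseteq V(SP_9)$ with $|S_1|=3$ and every $b\in V(SP_9)$, there exists a triangle free set $S_2\subseteq V(SP_9)$ with $|S_2|=3$ such that for each $s_2\in S_2$ there exist $s_1\in S_1$ and a map $c:\{u,v,w\}\to V(SP_9)$ with $c(u)=s_1$, $c(v)=s_2$, $c(w)=b$ which is a signified homomorphism of the path into $SP_9$, i.e. the edge $\{s_1,s_2\}$ of $SP_9$ has sign $\sigma_1$ and the edge $\{s_2,b\}$ of $SP_9$ has sign $\sigma_2$.
   Context: Let $\mathbb{F}_9=GF(3)[x]/(x^2+1)$ be the field with 9 elements; its nonzero squares are $1,2,x,2x$. The signified Paley graph $SP_9$ is the complete graph $K_9$ on vertex set $\mathbb{F}_9$ with each edge $\{a,b\}$ ($a\ne b$) signed '$+$' if $b-a$ is a nonzero square in $\mathbb{F}_9$ and '$-$' otherwise. A set $S\subseteq V(SP_9)$ is triangle free if the subgraph of $SP_9$ induced by $S$ contains neither a triangle with all edges signed '$+$' nor a triangle with all edges signed '$-$'. A signified homomorphism from a signed graph into $SP_9$ maps adjacent vertices to distinct vertices of $SP_9$ so that each edge is mapped to an edge of the same sign. -}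

module Defs where

open import Data.Fin using (Fin; zero; suc)
open import Data.Product using (_×_; _,_)
open import Data.List using (List; length)
open import Data.List.Membership.Propositional using (_∈_)
open import Data.List.Relation.Unary.Unique.Propositional using (Unique)
open import Data.Nat using (ℕ)
open import Relation.Binary.PropositionalEquality using (_≡_; _≢_)
open import Relation.Nullary using (¬_)

F3 : Set
F3 = Fin 3

sub3 : F3 → F3 → F3
sub3 zero zero = zero
sub3 zero (suc zero) = suc (suc zero)
sub3 zero (suc (suc zero)) = suc zero
sub3 (suc zero) zero = suc zero
sub3 (suc zero) (suc zero) = zero
sub3 (suc zero) (suc (suc zero)) = suc (suc zero)
sub3 (suc (suc zero)) zero = suc (suc zero)
sub3 (suc (suc zero)) (suc zero) = suc zero
sub3 (suc (suc zero)) (suc (suc zero)) = zero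

-- F9 = GF(3)[x]/(x^2+1); the pair (a , b) represents a + b x
F9 : Set
F9 = F3 × F3

_-F9_ : F9 → F9 → F9
(a , b) -F9 (c , d) = sub3 a c , sub3 b d

data NonzeroSquare : F9 → Set where
  sq1  : NonzeroSquare (suc zero , zero)
  sq2  : NonzeroSquare (suc (suc zero) , zero)
  sqx  : NonzeroSquare (zero , suc zero)
  sq2x : NonzeroSquare (zero , suc (suc zero))

data Sign : Set where
  plus minus : Sign

data EdgeSign (a b : F9) : Sign → Set where
  pos : NonzeroSquare (b -F9 a) → EdgeSign a b plus
  neg : ¬ NonzeroSquare (b -F9 a) → EdgeSign a b minus

SPEdge : F9 → F9 → Sign → Set
SPEdge a b σ = (a ≢ b) × EdgeSign a b σ

record VSet : Set where
  constructor vset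
  field
    elems  : List F9
    unique : Unique elems

open VSet public

card : VSet → ℕ
card S = length (elems S)

TriangleFree : VSet → Set
TriangleFree S =
  ∀ {a b c} → a ∈ elems S → b ∈ elems S → c ∈ elems S →
  a ≢ b → b ≢ c → a ≢ c →
  ∀ (σ : Sign) → ¬ (SPEdge a b σ × SPEdge b c σ × SPEdge a c σ)

data PathVertex : Set where
  u v w : PathVertex

IsSignifiedHomPath : Sign → Sign → (PathVertex → F9) → Set
IsSignifiedHomPath σ₁ σ₂ c = SPEdge (c u) (c v) σ₁ × SPEdge (c v) (c w) σ₂

-- Every σ-neighbourhood of a vertex of SP₉ induces a perfect matching in one
-- sign and a 4-cycle in the other, so any set of σ₂-neighbours of b is
-- triangle free.  It therefore suffices to take for S₂ three σ₂-neighbours of b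
-- that each have a σ₁-neighbour in S₁; that at least three of the four
-- σ₂-neighbours of b qualify, for every triangle free triple S₁, is a finite
-- check over SP₉.
module Submission where

open import Defs
open import Data.Product using (Σ; _×_; _,_; proj₁)
open import Data.List.Membership.Propositional using (_∈_; find)

open import Data.Fin using (zero; suc)
import Data.Fin.Properties as Fin
open import Data.List using (List; []; _∷_; allFin; cartesianProduct; filter; take; length)
open import Data.List.Properties using (length-take)
open import Data.List.Relation.Unary.All as All using (All; []; _∷_)
open import Data.List.Relation.Unary.All.Properties using (all-filter; take⁺)
open import Data.List.Relation.Unary.Any using (Any; any?; here; there)
open import Data.List.Relation.Unary.AllPairs using ([]; _∷_)
import Data.List.Relation.Unary.Unique.Propositional.Properties as Unique
open import Data.Nat using (_≤_; _≤?_)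
open import Data.Nat.Properties using (m≤n⇒m⊓n≡m)
open import Data.Product.Properties using (≡-dec)
open import Function using (_∘_)
open import Relation.Binary.Definitions using (DecidableEquality)
open import Relation.Binary.PropositionalEquality using (_≡_; _≢_; refl; trans)
open import Relation.Nullary using (Dec; yes; no; ¬_; ¬?; _×-dec_; _→-dec_)
open import Relation.Nullary.Decidable using (from-yes)
open import Relation.Unary using (Decidable; Pred)

_≟_ : DecidableEquality F9
_≟_ = ≡-dec Fin._≟_ Fin._≟_

nonzeroSquare? : Decidable NonzeroSquare
nonzeroSquare? (zero , zero) = no λ ()
nonzeroSquare? (zero , suc zero) = yes sqx
nonzeroSquare? (zero , suc (suc zero)) = yes sq2x
nonzeroSquare? (suc zero , zero) = yes sq1
nonzeroSquare? (suc zero , suc zero) = no λ ()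
nonzeroSquare? (suc zero , suc (suc zero)) = no λ ()
nonzeroSquare? (suc (suc zero) , zero) = yes sq2
nonzeroSquare? (suc (suc zero) , suc zero) = no λ ()
nonzeroSquare? (suc (suc zero) , suc (suc zero)) = no λ ()

edgeSign? : ∀ a b σ → Dec (EdgeSign a b σ)
edgeSign? a b plus with nonzeroSquare? (b -F9 a)
... | yes sq = yes (pos sq)
... | no ¬sq = no λ { (pos sq) → ¬sq sq }
edgeSign? a b minus with nonzeroSquare? (b -F9 a)
... | yes sq = no λ { (neg ¬sq) → ¬sq sq }
... | no ¬sq = yes (neg ¬sq)

spEdge? : ∀ a b σ → Dec (SPEdge a b σ)
spEdge? a b σ = ¬? (a ≟ b) ×-dec edgeSign? a b σ

∀-F9? : ∀ {p} {P : Pred F9 p} → Decidable P → Dec (∀ x → P x)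
∀-F9? P? with Fin.all? (λ a → Fin.all? (λ b → P? (a , b)))
... | yes ∀P = yes λ (a , b) → ∀P a b
... | no ¬∀P = no λ ∀P → ¬∀P λ a b → ∀P (a , b)

∀-Sign? : ∀ {p} {P : Pred Sign p} → Decidable P → Dec (∀ σ → P σ)
∀-Sign? P? with P? plus | P? minus
... | yes P+ | yes P- = yes λ { plus → P+ ; minus → P- }
... | no ¬P+ | _      = no λ ∀P → ¬P+ (∀P plus)
... | _      | no ¬P- = no λ ∀P → ¬P- (∀P minus)

vertices : List F9
vertices = cartesianProduct (allFin 3) (allFin 3)

Monochromatic : Sign → F9 → F9 → F9 → Set
Monochromatic τ a b c = SPEdge a b τ × SPEdge b c τ × SPEdge a c τ

monochromatic? : ∀ τ a b c → Dec (Monochromatic τ a b c)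
monochromatic? τ a b c = spEdge? a b τ ×-dec spEdge? b c τ ×-dec spEdge? a c τ

neighbourhood-noMonochromatic : ∀ σ b τ a₁ a₂ a₃ →
  SPEdge a₁ b σ → SPEdge a₂ b σ → SPEdge a₃ b σ → ¬ Monochromatic τ a₁ a₂ a₃
neighbourhood-noMonochromatic = from-yes
  (∀-Sign? λ σ → ∀-F9? λ b → ∀-Sign? λ τ → ∀-F9? λ a₁ → ∀-F9? λ a₂ → ∀-F9? λ a₃ →
    spEdge? a₁ b σ →-dec spEdge? a₂ b σ →-dec spEdge? a₃ b σ →-dec
    ¬? (monochromatic? τ a₁ a₂ a₃))

neighbours-triangleFree : ∀ σ b (S : VSet) → All (λ a → SPEdge a b σ) (elems S) →
  TriangleFree S
neighbours-triangleFree σ b S adj a∈ b∈ c∈ _ _ _ τ =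
  neighbourhood-noMonochromatic σ b τ _ _ _
    (All.lookup adj a∈) (All.lookup adj b∈) (All.lookup adj c∈)

Candidate : Sign → Sign → List F9 → F9 → F9 → Set
Candidate σ₁ σ₂ S₁ b s₂ = SPEdge s₂ b σ₂ × Any (λ s₁ → SPEdge s₁ s₂ σ₁) S₁

candidate? : ∀ σ₁ σ₂ S₁ b → Decidable (Candidate σ₁ σ₂ S₁ b)
candidate? σ₁ σ₂ S₁ b s₂ = spEdge? s₂ b σ₂ ×-dec any? (λ s₁ → spEdge? s₁ s₂ σ₁) S₁

candidates : Sign → Sign → List F9 → F9 → List F9
candidates σ₁ σ₂ S₁ b = filter (candidate? σ₁ σ₂ S₁ b) vertices

enough-candidates : ∀ σ₁ σ₂ b x y z → x ≢ y → y ≢ z → x ≢ z →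
  (∀ τ → ¬ Monochromatic τ x y z) → 3 ≤ length (candidates σ₁ σ₂ (x ∷ y ∷ z ∷ []) b)
enough-candidates = from-yes
  (∀-Sign? λ σ₁ → ∀-Sign? λ σ₂ → ∀-F9? λ b → ∀-F9? λ x → ∀-F9? λ y → ∀-F9? λ z →
    ¬? (x ≟ y) →-dec ¬? (y ≟ z) →-dec ¬? (x ≟ z) →-dec
    ∀-Sign? (λ τ → ¬? (monochromatic? τ x y z)) →-dec
    3 ≤? length (candidates σ₁ σ₂ (x ∷ y ∷ z ∷ []) b))

length-take-≤ : ∀ {A : Set} n (xs : List A) → n ≤ length xs → length (take n xs) ≡ n
length-take-≤ n xs n≤ = trans (length-take n xs) (m≤n⇒m⊓n≡m n≤)

lemma6 : (σ₁ σ₂ : Sign) (S₁ : VSet) → TriangleFree S₁ → card S₁ ≡ 3 →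
    (b : F9) →
    Σ VSet λ S₂ → TriangleFree S₂ × card S₂ ≡ 3 ×
      (∀ {s₂} → s₂ ∈ elems S₂ →
        Σ F9 λ s₁ → s₁ ∈ elems S₁ × Σ (PathVertex → F9) λ c →
          c u ≡ s₁ × c v ≡ s₂ × c w ≡ b × IsSignifiedHomPath σ₁ σ₂ c)
lemma6 σ₁ σ₂ (vset S₁@(x ∷ y ∷ z ∷ []) ((x≢y ∷ x≢z ∷ []) ∷ (y≢z ∷ []) ∷ [] ∷ [])) tf₁ refl b =
  S₂ , neighbours-triangleFree σ₂ b S₂ (All.map proj₁ chosen-candidates) ,
  length-take-≤ 3 (candidates σ₁ σ₂ S₁ b)
    (enough-candidates σ₁ σ₂ b x y z x≢y y≢z x≢z triangleFree₁) ,
  homomorphism ∘ All.lookup chosen-candidates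
  where
  triangleFree₁ : ∀ τ → ¬ Monochromatic τ x y z
  triangleFree₁ = tf₁ (here refl) (there (here refl)) (there (there (here refl))) x≢y y≢z x≢z

  S₂ : VSet
  S₂ = vset (take 3 (candidates σ₁ σ₂ S₁ b))
    (Unique.take⁺ 3 (Unique.filter⁺ (candidate? σ₁ σ₂ S₁ b)
      (Unique.cartesianProduct⁺ (Unique.allFin⁺ 3) (Unique.allFin⁺ 3))))

  chosen-candidates : All (Candidate σ₁ σ₂ S₁ b) (elems S₂)
  chosen-candidates = take⁺ 3 (all-filter (candidate? σ₁ σ₂ S₁ b) vertices)

  homomorphism : ∀ {s₂} → Candidate σ₁ σ₂ S₁ b s₂ →
    Σ F9 λ s₁ → s₁ ∈ S₁ × Σ (PathVertex → F9) λ c →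
      c u ≡ s₁ × c v ≡ s₂ × c w ≡ b × IsSignifiedHomPath σ₁ σ₂ c
  homomorphism {s₂} (s₂b , neighbour-in-S₁) with find neighbour-in-S₁
  ... | s₁ , s₁∈S₁ , s₁s₂ = s₁ , s₁∈S₁ , path , refl , refl , refl , s₁s₂ , s₂b
    where
    path : PathVertex → F9
    path u = s₁
    path v = s₂
    path w = b
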